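{- Let $G$ be a graph with $V(G)=\{0\}\cup A\cup B$, $A=\{1,\dots,p\}$, $B=\{p+1,\dots,p+q\}$, $p,q\ge1$. Then $\mathcal{PF}(G)$ is invariant under the action of $\mathfrak{S}_p\times\mathfrak{S}_q$ if and only if $\mathcal{MPF}(G)$ is invariant under the action of $\mathfrak{S}_p\times\mathfrak{S}_q$.
   Context: A graph is a finite, connected, undirected, loopless multigraph with root $0$, viewed as a simple graph with an edge-weight function $wt$ counting parallel edges. For $U\subseteq V(G)$ and $i\in U$, $d_U(i)=\sum_{j\notin U}wt(\{i,j\})$. A $G$-parking function is $(b_1,\dots,b_{p+q})\in\mathbb{N}^{p+q}$ such that every non-empty $U\subseteq A\cup B$ contains some $i$ with $b_i<d_U(i)$; $\mathcal{PF}(G)$ is their set. $\mathcal{MPF}(G)$ is the set of $G$-parking functions that are maximal for the componentwise partial order. Write a sequence as $(\mathbf a,\mathbf b)$ with $\mathbf a=(b_1,\dots,b_p)$, $\mathbf b=(b_{p+1},\dots,b_{p+q})$; $(\sigma,\tau)\in\mathfrak{S}_p\times\mathfrak{S}_q$ acts by $(\mathbf a,\mathbf b)\mapsto(\sigma(\mathbf a),\tau(\mathbf b))$ (permuting entries). A set is invariant if it is closed under this action. -}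

module Defs where

open import Data.Nat using (ℕ; zero; suc; _+_; _<_; _≤_)
open import Data.Fin using (Fin; zero; suc; splitAt; _↑ˡ_; _↑ʳ_)
open import Data.Fin.Subset using (Subset; _∈_; Nonempty)
open import Data.Fin.Permutation using (Permutation′; _⟨$⟩ʳ_)
open import Data.Vec using (lookup)
open import Data.List using (map; allFin)
open import Data.Nat.ListAction using (sum)
open import Data.Bool using (Bool; true; false; if_then_else_)
open import Data.Sum using ([_,_])
open import Data.Product using (∃; _×_)
open import Relation.Binary.PropositionalEquality using (_≡_)

-- A multigraph on vertex set Fin (suc n): vertex 0 (Fin.zero) is the root,
-- the non-root vertices 1..n are  suc i  for i : Fin n.
-- wt i j = number of parallel edges between i and j.
Weight : ℕ → Set
Weight n = Fin (suc n) → Fin (suc n) → ℕ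

Symmetric : ∀ {n} → Weight n → Set
Symmetric wt = ∀ i j → wt i j ≡ wt j i

Loopless : ∀ {n} → Weight n → Set
Loopless wt = ∀ i → wt i i ≡ 0

data Reach {n} (wt : Weight n) : Fin (suc n) → Set where
  root : Reach wt zero
  step : ∀ {i j} → Reach wt i → 0 < wt i j → Reach wt j

Connected : ∀ {n} → Weight n → Set
Connected wt = ∀ v → Reach wt v

inU : ∀ {n} → Subset n → Fin (suc n) → Bool
inU U zero = false
inU U (suc j) = lookup U j

dU : ∀ {n} → Weight n → Subset n → Fin n → ℕ
dU {n} wt U i =
  sum (map (λ j → if inU U j then 0 else wt (suc i) j) (allFin (suc n)))

IsPF : ∀ {n} → Weight n → (Fin n → ℕ) → Set
IsPF {n} wt b = ∀ (U : Subset n) → Nonempty U → ∃ λ i → i ∈ U × b i < dU wt U i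

IsMPF : ∀ {n} → Weight n → (Fin n → ℕ) → Set
IsMPF {n} wt b =
  IsPF wt b × (∀ (c : Fin n → ℕ) → IsPF wt c → (∀ i → b i ≤ c i) → ∀ i → c i ≡ b i)

act : ∀ {p q} → Permutation′ p → Permutation′ q → (Fin (p + q) → ℕ) → (Fin (p + q) → ℕ)
act {p} {q} σ τ b k =
  [ (λ i → b ((σ ⟨$⟩ʳ i) ↑ˡ q)) , (λ j → b (p ↑ʳ (τ ⟨$⟩ʳ j))) ] (splitAt p k)

Invariant : ∀ p q → ((Fin (p + q) → ℕ) → Set) → Set
Invariant p q S = ∀ (σ : Permutation′ p) (τ : Permutation′ q) (b : Fin (p + q) → ℕ) → S b → S (act σ τ b)

{-# OPTIONS --safe #-}
-- Parking functions are closed downwards, and the bound b_i < d_{{i}}(i) makes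
-- them a finite set, so every parking function lies below a maximal one:
-- 𝒫ℱ(G) is the down-closure of ℳ𝒫ℱ(G).  The action of 𝔖_p × 𝔖_q is an
-- automorphism of the componentwise order, so it maps the maximal elements of
-- an invariant set to maximal elements, and the down-closure of an invariant
-- set is invariant.
module Submission where

open import Defs
open import Data.Nat using (ℕ; zero; suc; _+_; _∸_; _≤_; _<_; z≤n; _<?_)
open import Data.Nat.Properties
  using ( ≤-refl; ≤-trans; ≤-antisym; ≤-<-trans; <⇒≤; ≮⇒≥; n≤1+n
        ; +-mono-≤; +-mono-<-≤; +-mono-≤-<; ∸-monoʳ-≤; ∸-monoʳ-<)
open import Data.Nat.Induction using (<-wellFounded)
open import Induction.WellFounded using (Acc; acc)
open import Data.Fin using (Fin; zero; suc; splitAt; _≟_)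
open import Data.Fin.Properties using (any?; splitAt-↑ˡ; splitAt-↑ʳ; splitAt⁻¹-↑ˡ; splitAt⁻¹-↑ʳ)
open import Data.Fin.Subset using (Subset; _∈_; Nonempty; ⁅_⁆)
open import Data.Fin.Subset.Properties using (anySubset?; _∈?_; nonempty?; x∈⁅x⁆; x∈⁅y⁆⇒x≡y)
open import Data.Fin.Permutation using (Permutation′; _⟨$⟩ʳ_; flip; inverseˡ; inverseʳ)
open import Data.Vec.Functional using (updateAt)
open import Data.Vec.Functional.Properties using (updateAt-updates; updateAt-minimal)
open import Data.Product using (∃; _×_; _,_; proj₁)
open import Data.Sum using (inj₁; inj₂)
open import Function.Bundles using (_⇔_; mk⇔)
open import Relation.Nullary using (Dec; yes; no; ¬_; contradiction)
open import Relation.Nullary.Decidable using (_×-dec_; ¬?; decidable-stable)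
open import Relation.Binary.PropositionalEquality using (_≡_; refl; sym; cong; subst; _≗_; module ≡-Reasoning)

private
  variable
    n : ℕ

_≤ᵖ_ : (Fin n → ℕ) → (Fin n → ℕ) → Set
b ≤ᵖ c = ∀ i → b i ≤ c i

≤ᵖ-refl : {b : Fin n → ℕ} → b ≤ᵖ b
≤ᵖ-refl i = ≤-refl

≤ᵖ-trans : {a b c : Fin n → ℕ} → a ≤ᵖ b → b ≤ᵖ c → a ≤ᵖ c
≤ᵖ-trans a≤b b≤c i = ≤-trans (a≤b i) (b≤c i)

DownwardClosed : ((Fin n → ℕ) → Set) → Set
DownwardClosed P = ∀ {b c} → c ≤ᵖ b → P b → P c

Maximal : ((Fin n → ℕ) → Set) → (Fin n → ℕ) → Set
Maximal P b = P b × (∀ c → P c → b ≤ᵖ c → c ≗ b)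

BelowMaximal : ((Fin n → ℕ) → Set) → Set
BelowMaximal P = ∀ {b} → P b → ∃ λ m → Maximal P m × b ≤ᵖ m

sumᶠ : (Fin n → ℕ) → ℕ
sumᶠ {zero}  f = 0
sumᶠ {suc n} f = f zero + sumᶠ (λ j → f (suc j))

sumᶠ-mono : {f g : Fin n → ℕ} → f ≤ᵖ g → sumᶠ f ≤ sumᶠ g
sumᶠ-mono {zero}  f≤g = z≤n
sumᶠ-mono {suc n} f≤g = +-mono-≤ (f≤g zero) (sumᶠ-mono (λ j → f≤g (suc j)))

sumᶠ-strictMono : {f g : Fin n → ℕ} → f ≤ᵖ g → ∀ i → f i < g i → sumᶠ f < sumᶠ g
sumᶠ-strictMono f≤g zero    fi<gi = +-mono-<-≤ fi<gi (sumᶠ-mono (λ j → f≤g (suc j)))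
sumᶠ-strictMono f≤g (suc i) fi<gi =
  +-mono-≤-< (f≤g zero) (sumᶠ-strictMono (λ j → f≤g (suc j)) i fi<gi)

increment : (Fin n → ℕ) → Fin n → Fin n → ℕ
increment b i = updateAt b i suc

increment-at : (b : Fin n → ℕ) (i : Fin n) → increment b i i ≡ suc (b i)
increment-at b i = updateAt-updates i b

≤ᵖ-increment : (b : Fin n → ℕ) (i : Fin n) → b ≤ᵖ increment b i
≤ᵖ-increment b i j with j ≟ i
... | yes refl = subst (b j ≤_) (sym (increment-at b j)) (n≤1+n _)
... | no j≢i   = subst (b j ≤_) (sym (updateAt-minimal j i b j≢i)) ≤-refl

increment-≤ᵖ : {b c : Fin n → ℕ} {i : Fin n} → b ≤ᵖ c → b i < c i → increment b i ≤ᵖ c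
increment-≤ᵖ {b = b} {c} {i} b≤c bi<ci j with j ≟ i
... | yes refl = subst (_≤ c j) (sym (increment-at b j)) bi<ci
... | no j≢i   = subst (_≤ c j) (sym (updateAt-minimal j i b j≢i)) (b≤c j)

module _ {P : (Fin n → ℕ) → Set} (P? : ∀ b → Dec (P b)) (P-down : DownwardClosed P)
         (bound : Fin n → ℕ) (P-bounded : ∀ {b} → P b → ∀ i → b i < bound i) where

  private
    gap : (Fin n → ℕ) → ℕ
    gap b = sumᶠ (λ i → bound i ∸ b i)

    gap-increment : ∀ b i → P (increment b i) → gap (increment b i) < gap b
    gap-increment b i P↑ =
      sumᶠ-strictMono (λ j → ∸-monoʳ-≤ (bound j) (≤ᵖ-increment b i j)) i
        (subst (λ x → bound i ∸ x < bound i ∸ b i) (sym (increment-at b i))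
          (∸-monoʳ-< ≤-refl (<⇒≤ (subst (_< bound i) (increment-at b i) (P-bounded P↑ i)))))

    maximal-if-unincrementable : ∀ {b} → P b → (∀ i → ¬ P (increment b i)) → Maximal P b
    maximal-if-unincrementable {b} Pb stuck = Pb , maximal
      where
      maximal : ∀ c → P c → b ≤ᵖ c → c ≗ b
      maximal c Pc b≤c i with b i <? c i
      ... | yes bi<ci = contradiction (P-down (increment-≤ᵖ b≤c bi<ci) Pc) (stuck i)
      ... | no bi≮ci  = ≤-antisym (≮⇒≥ bi≮ci) (b≤c i)

    climb : ∀ b → Acc _<_ (gap b) → P b → ∃ λ m → Maximal P m × b ≤ᵖ m
    climb b (acc smaller) Pb with any? (λ i → P? (increment b i))
    ... | yes (i , P↑) =
      let m , maximal , ↑≤m = climb (increment b i) (smaller (gap-increment b i P↑)) P↑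
      in  m , maximal , ≤ᵖ-trans (≤ᵖ-increment b i) ↑≤m
    ... | no stuck = b , maximal-if-unincrementable Pb (λ i P↑ → stuck (i , P↑)) , ≤ᵖ-refl

  belowMaximal : BelowMaximal P
  belowMaximal {b} = climb b (<-wellFounded (gap b))

module _ {p q : ℕ} where

  act-pointwise : (R : ℕ → ℕ → Set) (σ : Permutation′ p) (τ : Permutation′ q)
                  {b c : Fin (p + q) → ℕ} → (∀ k → R (b k) (c k)) →
                  ∀ k → R (act σ τ b k) (act σ τ c k)
  act-pointwise R σ τ bRc k with splitAt p k
  ... | inj₁ i = bRc _
  ... | inj₂ j = bRc _

  act-cancel : (σ σ′ : Permutation′ p) (τ τ′ : Permutation′ q) →
               (∀ i → σ ⟨$⟩ʳ (σ′ ⟨$⟩ʳ i) ≡ i) → (∀ j → τ ⟨$⟩ʳ (τ′ ⟨$⟩ʳ j) ≡ j) →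
               ∀ b → act σ′ τ′ (act σ τ b) ≗ b
  act-cancel σ σ′ τ τ′ σσ′ ττ′ b k with splitAt p k in split
  ... | inj₁ i rewrite splitAt-↑ˡ p (σ′ ⟨$⟩ʳ i) q | σσ′ i = cong b (splitAt⁻¹-↑ˡ split)
  ... | inj₂ j rewrite splitAt-↑ʳ p q (τ′ ⟨$⟩ʳ j) | ττ′ j = cong b (splitAt⁻¹-↑ʳ split)

  invariant-maximal : {S : (Fin (p + q) → ℕ) → Set} → Invariant p q S → Invariant p q (Maximal S)
  invariant-maximal {S} invariant σ τ b (Sb , b-maximal) = invariant σ τ b Sb , maximal
    where
    maximal : ∀ c → S c → act σ τ b ≤ᵖ c → c ≗ act σ τ b
    maximal c Sc σb≤c k = begin
      c k                                ≡⟨ act-cancel (flip σ) σ (flip τ) τ (λ _ → inverseˡ σ) (λ _ → inverseˡ τ) c k ⟨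
      act σ τ (act (flip σ) (flip τ) c) k ≡⟨ act-pointwise _≡_ σ τ c′≗b k ⟩
      act σ τ b k                        ∎
      where
      open ≡-Reasoning
      c′ : Fin (p + q) → ℕ
      c′ = act (flip σ) (flip τ) c
      c′≗b : c′ ≗ b
      c′≗b = b-maximal c′ (invariant (flip σ) (flip τ) c Sc) λ k →
        subst (_≤ c′ k) (act-cancel σ (flip σ) τ (flip τ) (λ _ → inverseʳ σ) (λ _ → inverseʳ τ) b k)
          (act-pointwise _≤_ (flip σ) (flip τ) σb≤c k)

  invariant-downClosure : {S : (Fin (p + q) → ℕ) → Set} → DownwardClosed S → BelowMaximal S →
                          Invariant p q (Maximal S) → Invariant p q S
  invariant-downClosure S-down below invariant σ τ b Sb =
    let m , m-maximal , b≤m = below Sb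
    in  S-down (act-pointwise _≤_ σ τ b≤m) (proj₁ (invariant σ τ m m-maximal))

module _ (wt : Weight n) where

  isPF-downwardClosed : DownwardClosed (IsPF wt)
  isPF-downwardClosed c≤b pf U U≢∅ =
    let i , i∈U , bi<d = pf U U≢∅ in i , i∈U , ≤-<-trans (c≤b i) bi<d

  private
    HasParkingWitness : (Fin n → ℕ) → Subset n → Set
    HasParkingWitness b U = ∃ λ i → i ∈ U × b i < dU wt U i

    hasParkingWitness? : ∀ b U → Dec (HasParkingWitness b U)
    hasParkingWitness? b U = any? (λ i → (i ∈? U) ×-dec (b i <? dU wt U i))

  isPF? : ∀ b → Dec (IsPF wt b)
  isPF? b with anySubset? {P = λ U → Nonempty U × ¬ HasParkingWitness b U}
                 (λ U → nonempty? U ×-dec ¬? (hasParkingWitness? b U))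
  ... | yes (U , U≢∅ , no-witness) = no λ pf → no-witness (pf U U≢∅)
  ... | no no-violation = yes λ U U≢∅ →
    decidable-stable (hasParkingWitness? b U) λ no-witness → no-violation (U , U≢∅ , no-witness)

  isPF⇒<degree : ∀ {b} → IsPF wt b → ∀ i → b i < dU wt ⁅ i ⁆ i
  isPF⇒<degree pf i with pf ⁅ i ⁆ (i , x∈⁅x⁆ i)
  ... | j , j∈⁅i⁆ , bj<d with x∈⁅y⁆⇒x≡y i j∈⁅i⁆
  ... | refl = bj<d

lemma6p2 : ∀ (p q : ℕ) → 1 ≤ p → 1 ≤ q → (wt : Weight (p + q)) →
    Symmetric wt → Loopless wt → Connected wt →
    Invariant p q (IsPF wt) ⇔ Invariant p q (IsMPF wt)
lemma6p2 p q _ _ wt _ _ _ =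
  mk⇔ invariant-maximal (invariant-downClosure (isPF-downwardClosed wt) belowMaximalPF)
  where
  belowMaximalPF : BelowMaximal (IsPF wt)
  belowMaximalPF = belowMaximal (isPF? wt) (isPF-downwardClosed wt) (λ i → dU wt ⁅ i ⁆ i) (isPF⇒<degree wt)
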